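{- Let $q$ be an odd prime power and $d$ a positive integer, and suppose that either $q\equiv 1 \pmod 4$ and $d$ is even, or $q\equiv 3\pmod 4$ and $d\equiv 0\pmod 4$. Then there exists a subset $\mathcal{P}\subseteq\mathbb{F}_q^d$ with $|\mathcal{P}|=q^{d/2}$ such that no spread is determined by points of $\mathcal{P}$.
   Context: For $\mathbf{u},\mathbf{v}\in\mathbb{F}_q^d$, $\mathbf{u}\cdot\mathbf{v}=\sum_{i=1}^d u_iv_i$ and $\|\mathbf{x}\|=\mathbf{x}\cdot\mathbf{x}$. For points $\mathbf{a},\mathbf{b},\mathbf{c}\in\mathbb{F}_q^d$, the spread $S(\mathbf{b},\mathbf{a},\mathbf{c})$ is $$S(\mathbf{b},\mathbf{a},\mathbf{c})=1-\frac{((\mathbf{b}-\mathbf{a})\cdot(\mathbf{c}-\mathbf{a}))^2}{\|\mathbf{b}-\mathbf{a}\|\,\|\mathbf{c}-\mathbf{a}\|},$$ undefined if either factor in the denominator is $0$. The spreads determined by $\mathcal{P}$ are the values $S(\mathbf{b},\mathbf{a},\mathbf{c})$ over all $\mathbf{a},\mathbf{b},\mathbf{c}\in\mathcal{P}$ for which it is defined; "no spread is determined" means the spread is undefined for every such triple. -}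

module Defs where

open import Level using (Level; suc; _⊔_)
open import Data.Nat using (ℕ)
open import Data.Fin using (Fin)
open import Data.Vec using (Vec; zipWith; foldr)
open import Data.Product using (Σ; _×_)
open import Relation.Binary.PropositionalEquality using (_≡_; _≢_)
open import Relation.Nullary using (¬_)
open import Algebra.Structures using (IsCommutativeRing)
open import Function.Bundles using (_↔_)

record Field (c : Level) : Set (suc c) where
  infixl 7 _*_
  infixl 6 _+_ _-_
  field
    Carrier : Set c
    _+_ _*_ : Carrier → Carrier → Carrier
    -_      : Carrier → Carrier
    0# 1#   : Carrier
    isCommutativeRing : IsCommutativeRing _≡_ _+_ _*_ -_ 0# 1#
    0≢1     : 0# ≢ 1#
    inverse : ∀ x → x ≢ 0# → Σ Carrier (λ y → x * y ≡ 1#)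

  _-_ : Carrier → Carrier → Carrier
  x - y = x + (- y)

record FiniteField (c : Level) (q : ℕ) : Set (suc c) where
  field
    field' : Field c
  open Field field' public
  field
    enum : Fin q ↔ Carrier

module _ {ℓ} (F : Field ℓ) where
  open Field F

  dot : ∀ {d} → Vec Carrier d → Vec Carrier d → Carrier
  dot u v = foldr _ _+_ 0# (zipWith _*_ u v)

  norm : ∀ {d} → Vec Carrier d → Carrier
  norm x = dot x x

  vsub : ∀ {d} → Vec Carrier d → Vec Carrier d → Vec Carrier d
  vsub = zipWith _-_

  SpreadDefined : ∀ {d} → (b a c : Vec Carrier d) → Set ℓ
  SpreadDefined b a c = (norm (vsub b a) ≢ 0#) × (norm (vsub c a) ≢ 0#)

module Submission where

-- A set P on which every difference is isotropic (‖b - a‖ = 0) determines no spread. If i² = -1,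
-- the line {(x, i x)} in F_q² is such a set, and if a² + b² = -1 so is the plane
-- {(x, y, a x + b y, b x - a y)} in F_q⁴; products of d/2 lines, resp. d/4 planes, give q^(d/2)
-- points of F_q^d. For odd q, -1 is always a sum of two squares: there are (q + 1)/2 values a² and
-- as many values -1 - b², so the two lists meet. If q ≡ 1 (mod 4), -1 is even a square: otherwise
-- x ↦ -x and x ↦ 1/x generate a Klein four-group acting freely on F_q ∖ {0, 1, -1}, forcing
-- 4 ∣ q - 3. All these counts (and 1 + 1 ≠ 0 for odd q) rest on one lemma: a free action of an
-- elementary abelian 2-group G on a finite set makes its size a multiple of |G|.

open import Defs
open import Level using (_⊔_)
open import Algebra.Bundles using (CommutativeRing)
open import Algebra.Structures using (IsCommutativeRing)
import Algebra.Properties.Ring as RingProperties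
import Algebra.Solver.Ring.NaturalCoefficients.Default as NaturalCoefficients
open import Data.Empty using (⊥-elim)
import Data.Fin as Fin
open import Data.List using (List; []; _∷_; length; _++_; map; filter; allFin; cartesianProduct; cartesianProductWith)
open import Data.List.Properties using (length-++; length-map; length-tabulate)
open import Data.List.Membership.Propositional using (_∈_; _∉_; find; lose)
open import Data.List.Membership.Propositional.Properties
  using (∈-length; ∈-allFin; ∈-cartesianProductWith⁻; ∈-filter⁺; ∈-filter⁻; ∈-++⁺ˡ; ∈-++⁺ʳ; ∈-++⁻;
         ∈-map⁺; ∈-map⁻)
open import Data.List.Membership.Propositional.Properties.WithK using (unique∧set⇒bag)
open import Data.List.Relation.Binary.BagAndSetEquality using (∼bag⇒↭)
open import Data.List.Relation.Binary.Disjoint.Propositional using (Disjoint)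
open import Data.List.Relation.Binary.Permutation.Propositional.Properties using (↭-length)
open import Data.List.Relation.Binary.Subset.Propositional using (_⊆_)
open import Data.List.Relation.Unary.All using ([]; _∷_)
import Data.List.Relation.Unary.All as All
open import Data.List.Relation.Unary.AllPairs using (AllPairs; []; _∷_)
import Data.List.Relation.Unary.AllPairs as AllPairs
import Data.List.Relation.Unary.AllPairs.Properties as AllPairsₚ
open import Data.List.Relation.Unary.Any using (here; there; any?)
open import Data.List.Relation.Unary.Unique.Propositional using (Unique)
import Data.List.Relation.Unary.Unique.Propositional.Properties as Unique
open import Data.Nat using (ℕ; zero; suc; _%_; _/_; _^_; _≥_)
import Data.Nat as ℕ
import Data.Nat.Properties as ℕₚ
open import Data.Nat.DivMod using (m*n%n≡0; [m+kn]%n≡m%n; m/n*n≡m; m*n/n≡m)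
open import Data.Nat.Divisibility using (m%n≡0⇒n∣m)
open import Data.Product using (Σ; ∃; ∃-syntax; _×_; _,_; proj₁; proj₂)
open import Data.Sum using (_⊎_; inj₁; inj₂; [_,_])
open import Data.Vec using (Vec; []; _∷_)
import Data.Vec as V
import Data.Vec.Properties as V
open import Function using (_∘_; case_of_)
open import Function.Bundles using (Inverse; Injection; mk⇔)
open import Function.Properties.Inverse using (↔-sym; Inverse⇒Injection)
open import Relation.Binary.Definitions using (DecidableEquality)
open import Relation.Binary.PropositionalEquality
  using (_≡_; _≢_; refl; sym; trans; cong; cong₂; subst; subst₂; module ≡-Reasoning)
open import Relation.Nullary using (¬_; Dec; yes; no; ¬?; contradiction)
open import Relation.Nullary.Decidable using (map′; via-injection)
open import Relation.Unary using (Decidable)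

module Counting {a} {A : Set a} (_≟_ : DecidableEquality A) where
  open import Data.Nat using (_+_; _*_; _≤_; _<_; s≤s)
  open ℕₚ
    using (≤-refl; ≤-trans; ≤-reflexive; m≤m+n; *-zeroʳ; *-suc; +-cancelˡ-≤; +-monoˡ-≤; <⇒≱; module ≤-Reasoning)
  open import Data.List.Membership.DecPropositional _≟_ using (_∈?_)

  infixl 6 _∖_
  _∖_ : List A → List A → List A
  xs ∖ ys = filter (λ x → ¬? (x ∈? ys)) xs

  ∈-∖⁻ : ∀ {x} {xs ys : List A} → x ∈ xs ∖ ys → x ∈ xs × x ∉ ys
  ∈-∖⁻ {xs = xs} {ys} = ∈-filter⁻ (λ x → ¬? (x ∈? ys)) {xs = xs}

  ∈-∖⁺ : ∀ {x} {xs ys : List A} → x ∈ xs → x ∉ ys → x ∈ xs ∖ ys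
  ∈-∖⁺ {ys = ys} = ∈-filter⁺ (λ x → ¬? (x ∈? ys))

  ∖-unique : ∀ {xs : List A} ys → Unique xs → Unique (xs ∖ ys)
  ∖-unique {xs} ys = Unique.filter⁺ (λ x → ¬? (x ∈? ys)) {xs}

  unique-⊆⊇⇒length≡ : ∀ {xs ys : List A} → Unique xs → Unique ys → xs ⊆ ys → ys ⊆ xs →
                      length xs ≡ length ys
  unique-⊆⊇⇒length≡ uxs uys xs⊆ys ys⊆xs =
    ↭-length (∼bag⇒↭ (unique∧set⇒bag uxs uys (λ {x} → mk⇔ (xs⊆ys {x}) (ys⊆xs {x}))))

  length-∖ : ∀ {xs ys : List A} → Unique xs → Unique ys → ys ⊆ xs →
             length xs ≡ length ys + length (xs ∖ ys)
  length-∖ {xs} {ys} uxs uys ys⊆xs = begin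
    length xs                     ≡⟨ unique-⊆⊇⇒length≡ uxs (Unique.++⁺ uys (∖-unique ys uxs) disjoint) split join ⟩
    length (ys ++ xs ∖ ys)        ≡⟨ length-++ ys ⟩
    length ys + length (xs ∖ ys)  ∎
    where
    open ≡-Reasoning
    disjoint : Disjoint ys (xs ∖ ys)
    disjoint (x∈ys , x∈xs∖ys) = proj₂ (∈-∖⁻ {xs = xs} x∈xs∖ys) x∈ys
    split : xs ⊆ ys ++ xs ∖ ys
    split {x} x∈xs with x ∈? ys
    ... | yes x∈ys = ∈-++⁺ˡ x∈ys
    ... | no  x∉ys = ∈-++⁺ʳ ys (∈-∖⁺ x∈xs x∉ys)
    join : ys ++ xs ∖ ys ⊆ xs
    join x∈ = [ ys⊆xs , proj₁ ∘ ∈-∖⁻ {xs = xs} ] (∈-++⁻ ys x∈)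

  module Enumerated {univ : List A} (univ-unique : Unique univ) (∈-univ : ∀ x → x ∈ univ) where

    length≤length-univ : ∀ {xs : List A} → Unique xs → length xs ≤ length univ
    length≤length-univ {xs} uxs =
      ≤-trans (m≤m+n (length xs) _) (≤-reflexive (sym (length-∖ univ-unique uxs (λ {x} _ → ∈-univ x))))

    pigeonhole : ∀ {xs ys : List A} → Unique xs → Unique ys → length univ < length xs + length ys →
                 ∃[ x ] x ∈ xs × x ∈ ys
    pigeonhole {xs} {ys} uxs uys univ<xs+ys with any? (_∈? ys) xs
    ... | yes x∈xs∩ys = find x∈xs∩ys
    ... | no  xs∩ys≡∅ = ⊥-elim (<⇒≱ univ<xs+ys (begin
      length xs + length ys  ≡⟨ length-++ xs ⟨
      length (xs ++ ys)      ≤⟨ length≤length-univ (Unique.++⁺ uxs uys disjoint) ⟩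
      length univ            ∎))
      where
      open ≤-Reasoning
      disjoint : Disjoint xs ys
      disjoint (x∈xs , x∈ys) = xs∩ys≡∅ (lose x∈xs x∈ys)

    ∖-closed : ∀ {E} (σ : A → A) → (∀ x → σ (σ x) ≡ x) → (∀ {e} → e ∈ E → σ e ∈ E) →
               ∀ {x} → x ∈ univ ∖ E → σ x ∈ univ ∖ E
    ∖-closed {E} σ σ-involutive σE⊆E {x} x∈ =
      ∈-∖⁺ (∈-univ (σ x))
           (λ σx∈E → proj₂ (∈-∖⁻ {xs = univ} x∈) (subst (_∈ E) (σ-involutive x) (σE⊆E σx∈E)))

  orbit : List (A → A) → A → List A
  orbit gs x = map (λ g → g x) gs

  -- An action of an elementary abelian 2-group, given as the list of its elements.
  record FreeInvolutionAction (gs : List (A → A)) (xs : List A) : Set a where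
    field
      identity    : (λ x → x) ∈ gs
      closed      : ∀ {g x} → g ∈ gs → x ∈ xs → g x ∈ xs
      involutive  : ∀ {g x} → g ∈ gs → x ∈ xs → g (g x) ≡ x
      composition : ∀ {g h} → g ∈ gs → h ∈ gs →
                    ∃[ k ] k ∈ gs × (∀ {x} → x ∈ xs → h (g x) ≡ k x)
      free        : ∀ {x} → x ∈ xs → Unique (orbit gs x)

    ∈-orbit : ∀ x → x ∈ orbit gs x
    ∈-orbit x = ∈-map⁺ (λ g → g x) identity

    orbit-⊆ : ∀ {x} → x ∈ xs → orbit gs x ⊆ xs
    orbit-⊆ {x} x∈xs z∈ with ∈-map⁻ (λ g → g x) z∈
    ... | g , g∈gs , refl = closed g∈gs x∈xs

    -- From z = g x and z = h y we get y = h (g x).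
    orbit-linked : ∀ {x y z} → x ∈ xs → y ∈ xs → z ∈ orbit gs x → z ∈ orbit gs y → y ∈ orbit gs x
    orbit-linked {x} {y} x∈xs y∈xs z∈Ox z∈Oy
      with ∈-map⁻ (λ g → g x) z∈Ox | ∈-map⁻ (λ h → h y) z∈Oy
    ... | g , g∈gs , refl | h , h∈gs , gx≡hy with composition g∈gs h∈gs
    ... | k , k∈gs , h∘g≡k = subst (_∈ orbit gs x) y≡kx (∈-map⁺ (λ g → g x) k∈gs)
      where
      y≡kx : k x ≡ y
      y≡kx = begin
        k x        ≡⟨ h∘g≡k x∈xs ⟨
        h (g x)    ≡⟨ cong h gx≡hy ⟩
        h (h y)    ≡⟨ involutive h∈gs y∈xs ⟩
        y          ∎
        where open ≡-Reasoning

    restrict : ∀ {x} → x ∈ xs → FreeInvolutionAction gs (xs ∖ orbit gs x)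
    restrict {x} x∈xs = record
      { identity    = identity
      ; closed      = λ {g} {y} g∈gs y∈ →
          let y∈xs , y∉Ox = ∈-∖⁻ {xs = xs} y∈ in
          ∈-∖⁺ (closed g∈gs y∈xs)
               (λ gy∈Ox → y∉Ox (orbit-linked x∈xs y∈xs gy∈Ox (∈-map⁺ (λ h → h y) g∈gs)))
      ; involutive  = λ g∈gs y∈ → involutive g∈gs (proj₁ (∈-∖⁻ {xs = xs} y∈))
      ; composition = λ g∈gs h∈gs → let k , k∈gs , h∘g≡k = composition g∈gs h∈gs in
                                    k , k∈gs , λ y∈ → h∘g≡k (proj₁ (∈-∖⁻ {xs = xs} y∈))
      ; free        = λ y∈ → free (proj₁ (∈-∖⁻ {xs = xs} y∈))
      }

  record Orbits (gs : List (A → A)) (xs : List A) : Set a where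
    field
      representatives   : List A
      length-≡          : length xs ≡ length gs * length representatives
      representatives-⊆ : representatives ⊆ xs
      distinct-orbits   : AllPairs (λ r s → s ∉ orbit gs r) representatives

  orbits : ∀ {gs} {xs : List A} → Unique xs → FreeInvolutionAction gs xs → Orbits gs xs
  orbits {xs = xs} = go xs (length xs) ≤-refl
    where
    go : ∀ {gs} (xs : List A) n → length xs ≤ n → Unique xs → FreeInvolutionAction gs xs → Orbits gs xs
    go {gs} [] _ _ _ _ = record
      { representatives = [] ; length-≡ = sym (*-zeroʳ (length gs)) ; representatives-⊆ = λ () ; distinct-orbits = [] }
    go {gs} (x ∷ xs) (suc n) (s≤s |xs|≤n) uxs act = record
      { representatives   = x ∷ representatives
      ; length-≡          = begin
          suc (length xs)                             ≡⟨ |x∷xs|≡ ⟩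
          length O + length rest                      ≡⟨ cong₂ _+_ (length-map (λ g → g x) gs) length-≡ ⟩
          length gs + length gs * length representatives ≡⟨ *-suc (length gs) _ ⟨
          length gs * suc (length representatives)    ∎
      ; representatives-⊆ = λ { (here refl) → here refl ; (there r∈) → proj₁ (∈rest⁻ (representatives-⊆ r∈)) }
      ; distinct-orbits   = All.tabulate (λ r∈ → proj₂ (∈rest⁻ (representatives-⊆ r∈))) ∷ distinct-orbits
      }
      where
      open ≡-Reasoning
      open FreeInvolutionAction act
      O = orbit gs x
      rest = (x ∷ xs) ∖ O
      ∈rest⁻ : ∀ {y} → y ∈ rest → y ∈ x ∷ xs × y ∉ O
      ∈rest⁻ = ∈-∖⁻ {xs = x ∷ xs}
      |x∷xs|≡ : length (x ∷ xs) ≡ length O + length rest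
      |x∷xs|≡ = length-∖ uxs (free (here refl)) (orbit-⊆ (here refl))
      |rest|≤n : length rest ≤ n
      |rest|≤n = ≤-trans (+-cancelˡ-≤ 1 _ _ 1+|rest|≤1+|xs|) |xs|≤n
        where
        1+|rest|≤1+|xs| : 1 + length rest ≤ 1 + length xs
        1+|rest|≤1+|xs| = ≤-trans (+-monoˡ-≤ (length rest) (∈-length (∈-orbit x))) (≤-reflexive (sym |x∷xs|≡))
      open Orbits (go rest n |rest|≤n (∖-unique O uxs) (restrict (here refl)))

  klein-four : (σ τ : A → A) → List (A → A)
  klein-four σ τ = (λ x → x) ∷ σ ∷ τ ∷ (σ ∘ τ) ∷ []

  module _ {xs : List A} (σ : A → A)
           (σ-closed : ∀ {x} → x ∈ xs → σ x ∈ xs) (σ-involutive : ∀ {x} → x ∈ xs → σ (σ x) ≡ x)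
           where

    involution-composition : ∀ {g h} → g ∈ (λ x → x) ∷ σ ∷ [] → h ∈ (λ x → x) ∷ σ ∷ [] →
                             ∃[ k ] k ∈ (λ x → x) ∷ σ ∷ [] × (∀ {x} → x ∈ xs → h (g x) ≡ k x)
    involution-composition {g} g∈ (here refl)                  = g , g∈ , λ _ → refl
    involution-composition (here refl) h∈                      = _ , h∈ , λ _ → refl
    involution-composition (there (here refl)) (there (here refl)) = _ , here refl , σ-involutive

    involution-action : (∀ {x} → x ∈ xs → x ≢ σ x) → FreeInvolutionAction ((λ x → x) ∷ σ ∷ []) xs
    involution-action x≢σx = record
      { identity    = here refl
      ; closed      = λ { (here refl) x∈ → x∈ ; (there (here refl)) x∈ → σ-closed x∈ }
      ; involutive  = λ { (here refl) _ → refl ; (there (here refl)) x∈ → σ-involutive x∈ }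
      ; composition = involution-composition
      ; free        = λ x∈ → (x≢σx x∈ ∷ []) ∷ [] ∷ []
      }

    module _ (τ : A → A)
             (τ-closed : ∀ {x} → x ∈ xs → τ x ∈ xs) (τ-involutive : ∀ {x} → x ∈ xs → τ (τ x) ≡ x)
             (στ≡τσ : ∀ {x} → x ∈ xs → σ (τ x) ≡ τ (σ x))
             where

      τστ≡σ : ∀ {x} → x ∈ xs → τ (σ (τ x)) ≡ σ x
      τστ≡σ {x} x∈ = trans (cong τ (στ≡τσ x∈)) (τ-involutive (σ-closed x∈))

      στσ≡τ : ∀ {x} → x ∈ xs → σ (τ (σ x)) ≡ τ x
      στσ≡τ {x} x∈ = trans (cong σ (sym (στ≡τσ x∈))) (σ-involutive (τ-closed x∈))

      στ-involutive : ∀ {x} → x ∈ xs → σ (τ (σ (τ x))) ≡ x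
      στ-involutive {x} x∈ = trans (cong σ (τστ≡σ x∈)) (σ-involutive x∈)

      klein-four-composition : ∀ {g h} → g ∈ klein-four σ τ → h ∈ klein-four σ τ →
                               ∃[ k ] k ∈ klein-four σ τ × (∀ {x} → x ∈ xs → h (g x) ≡ k x)
      klein-four-composition {g} g∈ (here refl) = g , g∈ , λ _ → refl
      klein-four-composition (here refl) h∈     = _ , h∈ , λ _ → refl
      klein-four-composition (there (here refl)) (there (here refl)) = _ , here refl , σ-involutive
      klein-four-composition (there (there (here refl))) (there (here refl)) =
        _ , there (there (there (here refl))) , λ _ → refl
      klein-four-composition (there (there (there (here refl)))) (there (here refl)) =
        _ , there (there (here refl)) , λ x∈ → σ-involutive (τ-closed x∈)
      klein-four-composition (there (here refl)) (there (there (here refl))) =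
        _ , there (there (there (here refl))) , λ x∈ → sym (στ≡τσ x∈)
      klein-four-composition (there (there (here refl))) (there (there (here refl))) =
        _ , here refl , τ-involutive
      klein-four-composition (there (there (there (here refl)))) (there (there (here refl))) =
        _ , there (here refl) , τστ≡σ
      klein-four-composition (there (here refl)) (there (there (there (here refl)))) =
        _ , there (there (here refl)) , στσ≡τ
      klein-four-composition (there (there (here refl))) (there (there (there (here refl)))) =
        _ , there (here refl) , λ x∈ → cong σ (τ-involutive x∈)
      klein-four-composition (there (there (there (here refl)))) (there (there (there (here refl)))) =
        _ , here refl , στ-involutive

      klein-four-action : (∀ {x} → x ∈ xs → Unique (x ∷ σ x ∷ τ x ∷ σ (τ x) ∷ [])) →
                          FreeInvolutionAction (klein-four σ τ) xs
      klein-four-action free = record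
        { identity    = here refl
        ; closed      = λ { (here refl) x∈ → x∈
                          ; (there (here refl)) x∈ → σ-closed x∈
                          ; (there (there (here refl))) x∈ → τ-closed x∈
                          ; (there (there (there (here refl)))) x∈ → σ-closed (τ-closed x∈) }
        ; involutive  = λ { (here refl) _ → refl
                          ; (there (here refl)) x∈ → σ-involutive x∈
                          ; (there (there (here refl))) x∈ → τ-involutive x∈
                          ; (there (there (there (here refl)))) x∈ → στ-involutive x∈ }
        ; composition = klein-four-composition
        ; free        = free
        }

module FieldProperties {ℓ} (F : Field ℓ) where
  open Field F
  open IsCommutativeRing isCommutativeRing
    using (+-identityʳ; -‿inverseʳ; *-assoc; *-comm; *-identityˡ; *-identityʳ; zeroʳ; distribˡ)

  commutativeRing : CommutativeRing ℓ ℓ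
  commutativeRing = record { isCommutativeRing = isCommutativeRing }

  open RingProperties (CommutativeRing.ring commutativeRing) public
    using (-‿involutive; -‿injective; -0#≈0#; -‿+-comm; +-cancelˡ; +-inverseˡ-unique; -‿distribˡ-*; -‿distribʳ-*;
           x∙y⁻¹≈ε⇒x≈y; x[y-z]≈xy-xz)
  open NaturalCoefficients (CommutativeRing.commutativeSemiring commutativeRing) public
    using (solve; _:=_; _:+_; _:*_; con)
  open ≡-Reasoning

  1≢0 : 1# ≢ 0#
  1≢0 = 0≢1 ∘ sym

  *-≢0 : ∀ {x y} → x ≢ 0# → y ≢ 0# → x * y ≢ 0#
  *-≢0 {x} {y} x≢0 y≢0 xy≡0 = y≢0 (begin
    y             ≡⟨ *-identityˡ y ⟨
    1# * y        ≡⟨ cong (_* y) x′x≡1 ⟨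
    x′ * x * y    ≡⟨ *-assoc x′ x y ⟩
    x′ * (x * y)  ≡⟨ cong (x′ *_) xy≡0 ⟩
    x′ * 0#       ≡⟨ zeroʳ x′ ⟩
    0#            ∎)
    where
    x′ = proj₁ (inverse x x≢0)
    x′x≡1 : x′ * x ≡ 1#
    x′x≡1 = trans (*-comm x′ x) (proj₂ (inverse x x≢0))

  -‿≢0 : ∀ {x} → x ≢ 0# → - x ≢ 0#
  -‿≢0 x≢0 -x≡0 = x≢0 (-‿injective (trans -x≡0 (sym -0#≈0#)))

  x≢-x : 1# + 1# ≢ 0# → ∀ {x} → x ≢ 0# → x ≢ - x
  x≢-x 2≢0 {x} x≢0 x≡-x = *-≢0 x≢0 2≢0 (begin
    x * (1# + 1#)    ≡⟨ distribˡ x 1# 1# ⟩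
    x * 1# + x * 1#  ≡⟨ cong₂ _+_ (*-identityʳ x) (*-identityʳ x) ⟩
    x + x            ≡⟨ cong (x +_) x≡-x ⟩
    x - x            ≡⟨ -‿inverseʳ x ⟩
    0#               ∎)

  -x*-y≡x*y : ∀ x y → - x * - y ≡ x * y
  -x*-y≡x*y x y = begin
    - x * - y      ≡⟨ -‿distribˡ-* x (- y) ⟨
    - (x * - y)    ≡⟨ cong -_ (-‿distribʳ-* x y) ⟨
    - - (x * y)    ≡⟨ -‿involutive (x * y) ⟩
    x * y          ∎

  [x-y][x+y]≡x²-y² : ∀ x y → (x - y) * (x + y) ≡ x * x - y * y
  [x-y][x+y]≡x²-y² x y = begin
    (x - y) * (x + y)
      ≡⟨ solve 3 (λ x y -y → (x :+ -y) :* (x :+ y) := x :* x :+ (x :* y :+ -y :* x) :+ -y :* y) refl x y (- y) ⟩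
    x * x + (x * y + - y * x) + - y * y  ≡⟨ cong₂ (λ u v → x * x + (x * y + u) + v) -yx≡-xy (-‿distribˡ-* y y) ⟨
    x * x + (x * y - x * y) - y * y      ≡⟨ cong (λ u → x * x + u - y * y) (-‿inverseʳ (x * y)) ⟩
    x * x + 0# - y * y                   ≡⟨ cong (_- y * y) (+-identityʳ (x * x)) ⟩
    x * x - y * y                        ∎
    where
    -yx≡-xy : - (x * y) ≡ - y * x
    -yx≡-xy = trans (cong -_ (*-comm x y)) (-‿distribˡ-* y x)

  x²≢y² : ∀ {x y} → x ≢ y → x ≢ - y → x * x ≢ y * y
  x²≢y² {x} {y} x≢y x≢-y x²≡y² =
    *-≢0 (x≢y ∘ x∙y⁻¹≈ε⇒x≈y x y) (x≢-y ∘ +-inverseˡ-unique x y) (begin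
      (x - y) * (x + y)  ≡⟨ [x-y][x+y]≡x²-y² x y ⟩
      x * x - y * y      ≡⟨ cong (_- y * y) x²≡y² ⟩
      y * y - y * y      ≡⟨ -‿inverseʳ (y * y) ⟩
      0#                 ∎)

  c≡-1⇒1+c≡0 : ∀ {c} → c ≡ - 1# → 1# + c ≡ 0#
  c≡-1⇒1+c≡0 c≡-1 = trans (cong (1# +_) c≡-1) (-‿inverseʳ 1#)

  a*x+b*y-[a*x′+b*y′] : ∀ a b x y x′ y′ → (a * x + b * y) - (a * x′ + b * y′) ≡ a * (x - x′) + b * (y - y′)
  a*x+b*y-[a*x′+b*y′] a b x y x′ y′ = begin
    (a * x + b * y) - (a * x′ + b * y′)        ≡⟨ cong ((a * x + b * y) +_) (-‿+-comm (a * x′) (b * y′)) ⟨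
    (a * x + b * y) + (- (a * x′) - b * y′)
      ≡⟨ cong₂ (λ s t → (a * x + b * y) + (s + t)) (-‿distribʳ-* a x′) (-‿distribʳ-* b y′) ⟩
    (a * x + b * y) + (a * - x′ + b * - y′)
      ≡⟨ solve 6 (λ a b x y -x′ -y′ → (a :* x :+ b :* y) :+ (a :* -x′ :+ b :* -y′)
                                      := a :* (x :+ -x′) :+ b :* (y :+ -y′))
               refl a b x y (- x′) (- y′) ⟩
    a * (x - x′) + b * (y - y′)                ∎

  inverse-unique : ∀ {x y z} → x * y ≡ 1# → x * z ≡ 1# → y ≡ z
  inverse-unique {x} {y} {z} xy≡1 xz≡1 = begin
    y             ≡⟨ *-identityʳ y ⟨
    y * 1#        ≡⟨ cong (y *_) xz≡1 ⟨
    y * (x * z)   ≡⟨ *-assoc y x z ⟨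
    y * x * z     ≡⟨ cong (_* z) (trans (*-comm y x) xy≡1) ⟩
    1# * z        ≡⟨ *-identityˡ z ⟩
    z             ∎

  module Reciprocal (_≟_ : DecidableEquality Carrier) where

    -- The junk value 0 ⁻¹ = 0 makes _⁻¹ an involution of the whole field.
    _⁻¹ : Carrier → Carrier
    x ⁻¹ with x ≟ 0#
    ... | yes _   = 0#
    ... | no  x≢0 = proj₁ (inverse x x≢0)

    x*x⁻¹≡1 : ∀ {x} → x ≢ 0# → x * x ⁻¹ ≡ 1#
    x*x⁻¹≡1 {x} x≢0 with x ≟ 0#
    ... | yes x≡0 = ⊥-elim (x≢0 x≡0)
    ... | no  x≢0 = proj₂ (inverse x x≢0)

    0⁻¹≡0 : 0# ⁻¹ ≡ 0#
    0⁻¹≡0 with 0# ≟ 0#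
    ... | yes _   = refl
    ... | no  0≢0 = ⊥-elim (0≢0 refl)

    1⁻¹≡1 : 1# ⁻¹ ≡ 1#
    1⁻¹≡1 = inverse-unique (x*x⁻¹≡1 1≢0) (*-identityʳ 1#)

    ⁻¹-≢0 : ∀ {x} → x ≢ 0# → x ⁻¹ ≢ 0#
    ⁻¹-≢0 {x} x≢0 x⁻¹≡0 = 1≢0 (trans (sym (x*x⁻¹≡1 x≢0)) (trans (cong (x *_) x⁻¹≡0) (zeroʳ x)))

    ⁻¹-involutive : ∀ x → x ⁻¹ ⁻¹ ≡ x
    ⁻¹-involutive x = case x ≟ 0# of λ where
      (yes x≡0) → begin
        x ⁻¹ ⁻¹    ≡⟨ cong (λ y → y ⁻¹ ⁻¹) x≡0 ⟩
        0# ⁻¹ ⁻¹   ≡⟨ cong _⁻¹ 0⁻¹≡0 ⟩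
        0# ⁻¹      ≡⟨ 0⁻¹≡0 ⟩
        0#         ≡⟨ x≡0 ⟨
        x          ∎
      (no x≢0) → inverse-unique (x*x⁻¹≡1 (⁻¹-≢0 x≢0)) (trans (*-comm (x ⁻¹) x) (x*x⁻¹≡1 x≢0))

    -‿⁻¹ : ∀ x → (- x) ⁻¹ ≡ - (x ⁻¹)
    -‿⁻¹ x = case x ≟ 0# of λ where
      (yes x≡0) → begin
        (- x) ⁻¹   ≡⟨ cong (λ y → (- y) ⁻¹) x≡0 ⟩
        (- 0#) ⁻¹  ≡⟨ cong _⁻¹ -0#≈0# ⟩
        0# ⁻¹      ≡⟨ 0⁻¹≡0 ⟩
        0#         ≡⟨ -0#≈0# ⟨
        - 0#       ≡⟨ cong -_ 0⁻¹≡0 ⟨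
        - (0# ⁻¹)  ≡⟨ cong (λ y → - (y ⁻¹)) x≡0 ⟨
        - (x ⁻¹)   ∎
      (no x≢0) → inverse-unique (x*x⁻¹≡1 (-‿≢0 x≢0)) (trans (-x*-y≡x*y x (x ⁻¹)) (x*x⁻¹≡1 x≢0))

length-cartesianProductWith : ∀ {a b c} {A : Set a} {B : Set b} {C : Set c} (f : A → B → C) xs ys →
                              length (cartesianProductWith f xs ys) ≡ length xs ℕ.* length ys
length-cartesianProductWith f []       ys = refl
length-cartesianProductWith f (x ∷ xs) ys = begin
  length (map (f x) ys ++ cartesianProductWith f xs ys)  ≡⟨ length-++ (map (f x) ys) ⟩
  length (map (f x) ys) ℕ.+ length (cartesianProductWith f xs ys)
    ≡⟨ cong₂ ℕ._+_ (length-map (f x) ys) (length-cartesianProductWith f xs ys) ⟩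
  length ys ℕ.+ length xs ℕ.* length ys                      ∎
  where open ≡-Reasoning

module IsotropicSets {ℓ} (F : Field ℓ) where
  open Field F
  open FieldProperties F
  open IsCommutativeRing isCommutativeRing
    using (+-assoc; +-comm; +-identityˡ; +-identityʳ; -‿inverseʳ; *-comm; zeroˡ; distribˡ)
  open ≡-Reasoning

  TotallyIsotropic : ∀ {d} → List (Vec Carrier d) → Set ℓ
  TotallyIsotropic P = ∀ {a b} → a ∈ P → b ∈ P → norm F (vsub F a b) ≡ 0#

  totallyIsotropic⇒noSpread : ∀ {d} {P : List (Vec Carrier d)} → TotallyIsotropic P →
                              ∀ a b c → a ∈ P → b ∈ P → c ∈ P → ¬ SpreadDefined F b a c
  totallyIsotropic⇒noSpread isotropic a b c a∈P b∈P c∈P (‖b-a‖≢0 , _) = ‖b-a‖≢0 (isotropic b∈P a∈P)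

  norm-++ : ∀ {m n} (u : Vec Carrier m) (w : Vec Carrier n) → norm F (u V.++ w) ≡ norm F u + norm F w
  norm-++ []      w = sym (+-identityˡ (norm F w))
  norm-++ (x ∷ u) w = trans (cong (x * x +_) (norm-++ u w)) (sym (+-assoc (x * x) (norm F u) (norm F w)))

  IsotropicMap : ∀ {b n} {B : Set b} → (B → Vec Carrier n) → Set (b ⊔ ℓ)
  IsotropicMap g = ∀ x y → norm F (vsub F (g x) (g y)) ≡ 0#

  module _ {b n} {B : Set b} (g : B → Vec Carrier n) (xs : List B) where

    blocks : (m : ℕ) → List (Vec Carrier (m ℕ.* n))
    blocks zero    = [] ∷ []
    blocks (suc m) = cartesianProductWith (λ x w → g x V.++ w) xs (blocks m)

    length-blocks : ∀ m → length (blocks m) ≡ length xs ^ m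
    length-blocks zero    = refl
    length-blocks (suc m) =
      trans (length-cartesianProductWith _ xs (blocks m)) (cong (length xs ℕ.*_) (length-blocks m))

    blocks-unique : (∀ {x y} → g x ≡ g y → x ≡ y) → Unique xs → ∀ m → Unique (blocks m)
    blocks-unique g-injective uxs zero    = [] ∷ []
    blocks-unique g-injective uxs (suc m) = Unique.cartesianProductWith⁺ _
      (λ {x} {y} eq → g-injective (V.++-injectiveˡ (g x) (g y) eq) , V.++-injectiveʳ (g x) (g y) eq)
      uxs (blocks-unique g-injective uxs m)

    blocks-isotropic : IsotropicMap g → ∀ m → TotallyIsotropic (blocks m)
    blocks-isotropic g-isotropic zero    (here refl) (here refl) = refl
    blocks-isotropic g-isotropic (suc m) a∈ b∈
      with ∈-cartesianProductWith⁻ (λ x w → g x V.++ w) xs (blocks m) a∈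
         | ∈-cartesianProductWith⁻ (λ x w → g x V.++ w) xs (blocks m) b∈
    ... | x , w , _ , w∈ , refl | y , w′ , _ , w′∈ , refl = begin
      norm F (vsub F (g x V.++ w) (g y V.++ w′))              ≡⟨ cong (norm F) (V.zipWith-++ _-_ (g x) w (g y) w′) ⟩
      norm F (vsub F (g x) (g y) V.++ vsub F w w′)            ≡⟨ norm-++ (vsub F (g x) (g y)) (vsub F w w′) ⟩
      norm F (vsub F (g x) (g y)) + norm F (vsub F w w′)
        ≡⟨ cong₂ _+_ (g-isotropic x y) (blocks-isotropic g-isotropic m w∈ w′∈) ⟩
      0# + 0#                                                 ≡⟨ +-identityʳ 0# ⟩
      0#                                                      ∎

  spread-free-set : ∀ {b n} {B : Set b} (g : B → Vec Carrier n) → (∀ {x y} → g x ≡ g y → x ≡ y) →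
                    IsotropicMap g → ∀ {xs : List B} → Unique xs → ∀ {d N} m → d ≡ m ℕ.* n → N ≡ length xs ^ m →
                    Σ (List (Vec Carrier d)) λ P → Unique P × length P ≡ N ×
                      (∀ a b c → a ∈ P → b ∈ P → c ∈ P → ¬ SpreadDefined F b a c)
  spread-free-set g g-injective g-isotropic {xs} uxs m refl refl =
    blocks g xs m , blocks-unique g xs g-injective uxs m , length-blocks g xs m ,
    totallyIsotropic⇒noSpread (blocks-isotropic g xs g-isotropic m)

  line : Carrier → Carrier → Vec Carrier 2
  line i x = x ∷ i * x ∷ []

  line-injective : ∀ i {x y} → line i x ≡ line i y → x ≡ y
  line-injective i = V.∷-injectiveˡ

  line-isotropic : ∀ {i} → i * i ≡ - 1# → IsotropicMap (line i)
  line-isotropic {i} i²≡-1 x y = begin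
    (x - y) * (x - y) + ((i * x - i * y) * (i * x - i * y) + 0#)
      ≡⟨ cong (λ v → (x - y) * (x - y) + (v * v + 0#)) (x[y-z]≈xy-xz i x y) ⟨
    u * u + (i * u * (i * u) + 0#)
      ≡⟨ solve 2 (λ u i → u :* u :+ (i :* u :* (i :* u) :+ con 0) := (con 1 :+ i :* i) :* (u :* u)) refl u i ⟩
    (1# + i * i) * (u * u)  ≡⟨ cong (_* (u * u)) (c≡-1⇒1+c≡0 i²≡-1) ⟩
    0# * (u * u)            ≡⟨ zeroˡ (u * u) ⟩
    0#                      ∎
    where u = x - y

  plane : Carrier → Carrier → Carrier × Carrier → Vec Carrier 4
  plane a b (x , y) = x ∷ y ∷ a * x + b * y ∷ b * x + (- a) * y ∷ []

  plane-injective : ∀ a b {p p′} → plane a b p ≡ plane a b p′ → p ≡ p′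
  plane-injective a b {x , y} {x′ , y′} eq = cong₂ _,_ (V.∷-injectiveˡ eq) (V.∷-injectiveˡ (V.∷-injectiveʳ eq))

  -- Lagrange's identity (a u + b v)² + (b u - a v)² = (a² + b²)(u² + v²); the semiring solver sees
  -- c = - a as an atom, so c² = a² and a b + b c = 0 are supplied by hand.
  norm-plane : ∀ a b u v → norm F (plane a b (u , v)) ≡ (1# + (a * a + b * b)) * (u * u + v * v)
  norm-plane a b u v = begin
    u * u + (v * v + ((a * u + b * v) * (a * u + b * v) + ((b * u + c * v) * (b * u + c * v) + 0#)))
      ≡⟨ solve 6 (λ a b c u v z →
           u :* u :+ (v :* v :+ ((a :* u :+ b :* v) :* (a :* u :+ b :* v)
                                 :+ ((b :* u :+ c :* v) :* (b :* u :+ c :* v) :+ z)))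
           := (con 1 :+ (a :* a :+ b :* b)) :* (u :* u) :+ (con 1 :+ (b :* b :+ c :* c)) :* (v :* v)
              :+ (a :* b :+ b :* c) :* (u :* v :+ u :* v) :+ z)
           refl a b c u v 0# ⟩
    p * (u * u) + (1# + (b * b + c * c)) * (v * v) + (a * b + b * c) * (u * v + u * v) + 0#
      ≡⟨ cong₂ (λ s t → p * (u * u) + (1# + s) * (v * v) + t * (u * v + u * v) + 0#) b²+c²≡a²+b² ab+bc≡0 ⟩
    p * (u * u) + p * (v * v) + 0# * (u * v + u * v) + 0#
      ≡⟨ cong (λ t → p * (u * u) + p * (v * v) + t + 0#) (zeroˡ (u * v + u * v)) ⟩
    p * (u * u) + p * (v * v) + 0# + 0#
      ≡⟨ trans (+-identityʳ _) (+-identityʳ _) ⟩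
    p * (u * u) + p * (v * v)  ≡⟨ distribˡ p (u * u) (v * v) ⟨
    p * (u * u + v * v)        ∎
    where
    c = - a
    p = 1# + (a * a + b * b)
    b²+c²≡a²+b² : b * b + c * c ≡ a * a + b * b
    b²+c²≡a²+b² = trans (cong (b * b +_) (-x*-y≡x*y a a)) (+-comm (b * b) (a * a))
    ab+bc≡0 : a * b + b * c ≡ 0#
    ab+bc≡0 = trans (cong (a * b +_) (trans (sym (-‿distribʳ-* b a)) (cong -_ (*-comm b a)))) (-‿inverseʳ (a * b))

  plane-isotropic : ∀ {a b} → a * a + b * b ≡ - 1# → IsotropicMap (plane a b)
  plane-isotropic {a} {b} a²+b²≡-1 (x , y) (x′ , y′) = begin
    norm F (vsub F (plane a b (x , y)) (plane a b (x′ , y′)))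
      ≡⟨ cong₂ (λ s t → norm F (x - x′ ∷ y - y′ ∷ s ∷ t ∷ []))
           (a*x+b*y-[a*x′+b*y′] a b x y x′ y′) (a*x+b*y-[a*x′+b*y′] b (- a) x y x′ y′) ⟩
    norm F (plane a b (u , v))               ≡⟨ norm-plane a b u v ⟩
    (1# + (a * a + b * b)) * (u * u + v * v)  ≡⟨ cong (_* (u * u + v * v)) (c≡-1⇒1+c≡0 a²+b²≡-1) ⟩
    0# * (u * u + v * v)                      ≡⟨ zeroˡ (u * u + v * v) ⟩
    0#                                        ∎
    where
    u = x - x′
    v = y - y′

[2*n]%2≡0 : ∀ n → (2 ℕ.* n) % 2 ≡ 0
[2*n]%2≡0 n = trans (cong (_% 2) (ℕₚ.*-comm 2 n)) (m*n%n≡0 n 2)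

1+2n<[1+n]+[1+n] : ∀ n → suc (2 ℕ.* n) ℕ.< suc n ℕ.+ suc n
1+2n<[1+n]+[1+n] n =
  ℕₚ.≤-reflexive (cong suc (trans (cong (λ k → suc (n ℕ.+ k)) (ℕₚ.+-identityʳ n)) (sym (ℕₚ.+-suc n n))))

[3+4*n]%4≡3 : ∀ n → (3 ℕ.+ 4 ℕ.* n) % 4 ≡ 3
[3+4*n]%4≡3 n = trans (cong (λ k → (3 ℕ.+ k) % 4) (ℕₚ.*-comm 4 n)) ([m+kn]%n≡m%n 3 n 4)

d≡[d/n]*n : ∀ d n .{{_ : ℕ.NonZero n}} → d % n ≡ 0 → d ≡ d / n ℕ.* n
d≡[d/n]*n d n d%n≡0 = sym (m/n*n≡m (m%n≡0⇒n∣m d n d%n≡0))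

q^[d/2]≡[q*q]^[d/4] : ∀ q d → d % 4 ≡ 0 → q ^ (d / 2) ≡ (q ℕ.* q) ^ (d / 4)
q^[d/2]≡[q*q]^[d/4] q d d%4≡0 = begin
  q ^ (d / 2)              ≡⟨ cong (λ k → q ^ (k / 2)) (trans (d≡[d/n]*n d 4 d%4≡0) (sym (ℕₚ.*-assoc m 2 2))) ⟩
  q ^ (m ℕ.* 2 ℕ.* 2 / 2)  ≡⟨ cong (q ^_) (trans (m*n/n≡m (m ℕ.* 2) 2) (ℕₚ.*-comm m 2)) ⟩
  q ^ (2 ℕ.* m)            ≡⟨ ℕₚ.^-*-assoc q 2 m ⟨
  (q ^ 2) ^ m              ≡⟨ cong (λ k → (q ℕ.* k) ^ m) (ℕₚ.*-identityʳ q) ⟩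
  (q ℕ.* q) ^ m            ∎
  where
  open ≡-Reasoning
  m = d / 4

module FiniteFieldProperties {ℓ q} (F : FiniteField ℓ q) where
  open FiniteField F
  open FieldProperties field'
  open IsCommutativeRing isCommutativeRing using (+-assoc; +-identityʳ; -‿inverseˡ; *-identityʳ; zeroʳ)

  infix 4 _≟_
  _≟_ : DecidableEquality Carrier
  _≟_ = via-injection (Inverse⇒Injection (↔-sym enum)) Fin._≟_

  open Reciprocal _≟_
  open Counting _≟_

  elements : List Carrier
  elements = map (Inverse.to enum) (allFin q)

  elements-unique : Unique elements
  elements-unique = Unique.map⁺ (Injection.injective (Inverse⇒Injection enum)) (Unique.allFin⁺ q)

  ∈-elements : ∀ x → x ∈ elements
  ∈-elements x = subst (_∈ elements) (Inverse.strictlyInverseˡ enum x)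
                       (∈-map⁺ (Inverse.to enum) (∈-allFin (Inverse.from enum x)))

  length-elements : length elements ≡ q
  length-elements = trans (length-map (Inverse.to enum) (allFin q)) (length-tabulate (λ k → k))

  open Counting.Enumerated _≟_ elements-unique ∈-elements

  ∃? : ∀ {p} {P : Carrier → Set p} → Decidable P → Dec (∃ P)
  ∃? P? = map′ (λ ∃P → let x , _ , Px = find ∃P in x , Px)
               (λ (x , Px) → lose (∈-elements x) Px)
               (any? P? elements)

  -- x ↦ x + 1 would pair off the elements.
  1+1≡0⇒q%2≡0 : 1# + 1# ≡ 0# → q % 2 ≡ 0
  1+1≡0⇒q%2≡0 1+1≡0 = begin
    q % 2                             ≡⟨ cong (_% 2) (trans (sym length-elements) length-≡) ⟩
    (2 ℕ.* length representatives) % 2  ≡⟨ [2*n]%2≡0 (length representatives) ⟩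
    0                                 ∎
    where
    open ≡-Reasoning
    x≢x+1 : ∀ {x} → x ∈ elements → x ≢ x + 1#
    x≢x+1 {x} _ x≡x+1 = 0≢1 (+-cancelˡ x 0# 1# (trans (+-identityʳ x) x≡x+1))
    x+1+1≡x : ∀ {x} → x ∈ elements → x + 1# + 1# ≡ x
    x+1+1≡x {x} _ = trans (+-assoc x 1# 1#) (trans (cong (x +_) 1+1≡0) (+-identityʳ x))
    open Orbits (orbits elements-unique (involution-action (_+ 1#) (λ {x} _ → ∈-elements (x + 1#)) x+1+1≡x x≢x+1))

  odd⇒1+1≢0 : q % 2 ≡ 1 → 1# + 1# ≢ 0#
  odd⇒1+1≢0 q%2≡1 1+1≡0 = contradiction (trans (sym (1+1≡0⇒q%2≡0 1+1≡0)) q%2≡1) λ ()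

  module _ (2≢0 : 1# + 1# ≢ 0#) where

    nonzero : List Carrier
    nonzero = elements ∖ (0# ∷ [])

    ∈-nonzero⇒≢0 : ∀ {x} → x ∈ nonzero → x ≢ 0#
    ∈-nonzero⇒≢0 x∈ x≡0 = proj₂ (∈-∖⁻ {xs = elements} x∈) (here x≡0)

    negation-action : FreeInvolutionAction ((λ x → x) ∷ -_ ∷ []) nonzero
    negation-action = involution-action -_
      (∖-closed -_ -‿involutive λ { (here refl) → here -0#≈0# })
      (λ {x} _ → -‿involutive x) (x≢-x 2≢0 ∘ ∈-nonzero⇒≢0)

    -- 0 together with the squares of one representative of each pair {x, - x} of nonzero elements.
    many-squares : ∃[ S ] Unique S × length elements ℕ.< length S ℕ.+ length S ×
                          (∀ {v} → v ∈ S → ∃[ a ] v ≡ a * a)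
    many-squares = S , S-unique , |elements|<|S|+|S| , S-squares
      where
      open Orbits (orbits (∖-unique (0# ∷ []) elements-unique) negation-action)
      square : Carrier → Carrier
      square x = x * x
      S = 0# ∷ map square representatives
      distinct-squares : AllPairs (λ r s → square r ≢ square s) representatives
      distinct-squares = AllPairs.map
        (λ {r} {s} s∉Or → x²≢y² (s∉Or ∘ here ∘ sym)
                                (λ r≡-s → s∉Or (there (here (trans (sym (-‿involutive s)) (cong -_ (sym r≡-s)))))))
        distinct-orbits
      0∉squares : 0# ∉ map square representatives
      0∉squares 0∈ = let r , r∈ , 0≡r² = ∈-map⁻ square 0∈
                         r≢0 = ∈-nonzero⇒≢0 (representatives-⊆ r∈)
                     in *-≢0 r≢0 r≢0 (sym 0≡r²)
      S-unique : Unique S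
      S-unique = All.tabulate (λ v∈ 0≡v → 0∉squares (subst (_∈ _) (sym 0≡v) v∈)) ∷ AllPairsₚ.map⁺ distinct-squares
      S-squares : ∀ {v} → v ∈ S → ∃[ a ] v ≡ a * a
      S-squares (here refl) = 0# , sym (zeroʳ 0#)
      S-squares (there v∈)  = let r , _ , v≡r² = ∈-map⁻ square v∈ in r , v≡r²
      |S|≡1+n : length S ≡ suc (length representatives)
      |S|≡1+n = cong suc (length-map square representatives)
      |elements|≡1+2n : length elements ≡ suc (2 ℕ.* length representatives)
      |elements|≡1+2n = trans (length-∖ elements-unique ([] ∷ []) (λ {x} _ → ∈-elements x)) (cong suc length-≡)
      |elements|<|S|+|S| : length elements ℕ.< length S ℕ.+ length S
      |elements|<|S|+|S| = subst₂ ℕ._<_ (sym |elements|≡1+2n) (sym (cong₂ ℕ._+_ |S|≡1+n |S|≡1+n))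
                                  (1+2n<[1+n]+[1+n] (length representatives))

    -- Pigeonhole on the squares a² and the elements -1 - b²: there are more than q of them.
    sum-of-two-squares : ∃[ a ] ∃[ b ] a * a + b * b ≡ - 1#
    sum-of-two-squares =
      let S , S-unique , |elements|<|S|+|S| , S-squares = many-squares
          |elements|<|S|+|-1-S| = subst (length elements ℕ.<_) (cong (length S ℕ.+_) (sym (length-map reflect S)))
                                         |elements|<|S|+|S|
          v , v∈S , v∈-1-S = pigeonhole S-unique (Unique.map⁺ reflect-injective S-unique) |elements|<|S|+|-1-S|
          a , v≡a² = S-squares v∈S
          t , t∈S , v≡-1-t = ∈-map⁻ reflect v∈-1-S
          b , t≡b² = S-squares t∈S
      in a , b , (begin
        a * a + b * b      ≡⟨ cong₂ _+_ v≡a² t≡b² ⟨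
        v + t              ≡⟨ cong (_+ t) v≡-1-t ⟩
        - 1# - t + t       ≡⟨ +-assoc (- 1#) (- t) t ⟩
        - 1# + (- t + t)   ≡⟨ cong (- 1# +_) (-‿inverseˡ t) ⟩
        - 1# + 0#          ≡⟨ +-identityʳ (- 1#) ⟩
        - 1#               ∎)
      where
      open ≡-Reasoning
      reflect : Carrier → Carrier
      reflect t = - 1# - t
      reflect-injective : ∀ {s t} → reflect s ≡ reflect t → s ≡ t
      reflect-injective = -‿injective ∘ +-cancelˡ (- 1#) _ _

    0±1 : List Carrier
    0±1 = 0# ∷ 1# ∷ - 1# ∷ []

    0±1-unique : Unique 0±1
    0±1-unique = (0≢1 ∷ (λ 0≡-1 → -‿≢0 1≢0 (sym 0≡-1)) ∷ []) ∷ (x≢-x 2≢0 1≢0 ∷ []) ∷ [] ∷ []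

    -‿0±1⊆0±1 : ∀ {e} → e ∈ 0±1 → - e ∈ 0±1
    -‿0±1⊆0±1 (here refl)                 = here -0#≈0#
    -‿0±1⊆0±1 (there (here refl))         = there (there (here refl))
    -‿0±1⊆0±1 (there (there (here refl))) = there (here (-‿involutive 1#))

    0±1⁻¹⊆0±1 : ∀ {e} → e ∈ 0±1 → e ⁻¹ ∈ 0±1
    0±1⁻¹⊆0±1 (here refl)                 = here 0⁻¹≡0
    0±1⁻¹⊆0±1 (there (here refl))         = there (here 1⁻¹≡1)
    0±1⁻¹⊆0±1 (there (there (here refl))) = there (there (here (trans (-‿⁻¹ 1#) (cong -_ 1⁻¹≡1))))

    module _ (∄√-1 : ∀ i → i * i ≢ - 1#) where

      klein-orbit-unique : ∀ {x} → x ∉ 0±1 → Unique (x ∷ - x ∷ x ⁻¹ ∷ - (x ⁻¹) ∷ [])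
      klein-orbit-unique {x} x∉0±1 =
        (x≢-x 2≢0 x≢0 ∷ x≢x⁻¹ ∷ x≢-x⁻¹ ∷ []) ∷ (-x≢x⁻¹ ∷ x≢x⁻¹ ∘ -‿injective ∷ [])
        ∷ (x≢-x 2≢0 (⁻¹-≢0 x≢0) ∷ []) ∷ [] ∷ []
        where
        x≢0 : x ≢ 0#
        x≢0 = x∉0±1 ∘ here
        x≢x⁻¹ : x ≢ x ⁻¹
        x≢x⁻¹ x≡x⁻¹ = x²≢y² (x∉0±1 ∘ there ∘ here) (x∉0±1 ∘ there ∘ there ∘ here)
          (trans (cong (x *_) x≡x⁻¹) (trans (x*x⁻¹≡1 x≢0) (sym (*-identityʳ 1#))))
        x≢-x⁻¹ : x ≢ - (x ⁻¹)
        x≢-x⁻¹ x≡-x⁻¹ = ∄√-1 x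
          (trans (cong (x *_) x≡-x⁻¹) (trans (sym (-‿distribʳ-* x (x ⁻¹))) (cong -_ (x*x⁻¹≡1 x≢0))))
        -x≢x⁻¹ : - x ≢ x ⁻¹
        -x≢x⁻¹ -x≡x⁻¹ = x≢-x⁻¹ (trans (sym (-‿involutive x)) (cong -_ -x≡x⁻¹))

      klein-action : FreeInvolutionAction (klein-four -_ _⁻¹) (elements ∖ 0±1)
      klein-action = klein-four-action
        -_ (∖-closed -_ -‿involutive -‿0±1⊆0±1) (λ {x} _ → -‿involutive x)
        _⁻¹ (∖-closed _⁻¹ ⁻¹-involutive 0±1⁻¹⊆0±1) (λ {x} _ → ⁻¹-involutive x)
        (λ {x} _ → sym (-‿⁻¹ x)) (klein-orbit-unique ∘ proj₂ ∘ ∈-∖⁻ {xs = elements})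

      no-√-1⇒q%4≡3 : q % 4 ≡ 3
      no-√-1⇒q%4≡3 = begin
        q % 4                                          ≡⟨ cong (_% 4) length-elements ⟨
        length elements % 4                            ≡⟨ cong (_% 4) (length-∖ elements-unique 0±1-unique (λ {x} _ → ∈-elements x)) ⟩
        (3 ℕ.+ length (elements ∖ 0±1)) % 4            ≡⟨ cong (λ k → (3 ℕ.+ k) % 4) length-≡ ⟩
        (3 ℕ.+ 4 ℕ.* length representatives) % 4       ≡⟨ [3+4*n]%4≡3 (length representatives) ⟩
        3                                              ∎
        where
        open ≡-Reasoning
        open Orbits (orbits (∖-unique 0±1 elements-unique) klein-action)

  √-1 : q % 2 ≡ 1 → q % 4 ≡ 1 → ∃[ i ] i * i ≡ - 1#
  √-1 q%2≡1 q%4≡1 with ∃? (λ i → i * i ≟ - 1#)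
  ... | yes ∃√-1 = ∃√-1
  ... | no  ∄√-1 = contradiction (trans (sym q%4≡3) q%4≡1) λ ()
    where
    q%4≡3 : q % 4 ≡ 3
    q%4≡3 = no-√-1⇒q%4≡3 (odd⇒1+1≢0 q%2≡1) (λ i → ∄√-1 ∘ (i ,_))

theorem1p6 : ∀ {ℓ} (q d : ℕ) (F : FiniteField ℓ q) → q % 2 ≡ 1 → d ≥ 1 →
    ((q % 4 ≡ 1 × d % 2 ≡ 0) ⊎ (q % 4 ≡ 3 × d % 4 ≡ 0)) →
    Σ (List (Vec (FiniteField.Carrier F) d)) (λ P →
      Unique P × length P ≡ q ^ (d / 2) ×
      (∀ a b c → a ∈ P → b ∈ P → c ∈ P →
        ¬ SpreadDefined (FiniteField.field' F) b a c))
theorem1p6 q d F q%2≡1 _ (inj₁ (q%4≡1 , d%2≡0)) =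
  let i , i²≡-1 = √-1 q%2≡1 q%4≡1 in
  spread-free-set (line i) (line-injective i) (line-isotropic i²≡-1) elements-unique
    (d / 2) (d≡[d/n]*n d 2 d%2≡0) (cong (_^ (d / 2)) (sym length-elements))
  where
  open FiniteFieldProperties F
  open IsotropicSets (FiniteField.field' F)
theorem1p6 q d F q%2≡1 _ (inj₂ (_ , d%4≡0)) =
  let a , b , a²+b²≡-1 = sum-of-two-squares (odd⇒1+1≢0 q%2≡1) in
  spread-free-set (plane a b) (plane-injective a b) (plane-isotropic a²+b²≡-1)
    (Unique.cartesianProduct⁺ elements-unique elements-unique)
    (d / 4) (d≡[d/n]*n d 4 d%4≡0)
    (trans (q^[d/2]≡[q*q]^[d/4] q d d%4≡0) (cong (_^ (d / 4)) (sym |elements²|≡q*q)))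
  where
  open FiniteFieldProperties F
  open IsotropicSets (FiniteField.field' F)
  |elements²|≡q*q : length (cartesianProduct elements elements) ≡ q ℕ.* q
  |elements²|≡q*q =
    trans (length-cartesianProductWith _,_ elements elements) (cong₂ ℕ._*_ length-elements length-elements)
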